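{- Let $k,m$ be positive integers and $S_1,\dots,S_m\subseteq[k]\times[k]$ be sets each containing at most one element from each row, and let $G$ be the graph constructed from them as described in the context. Then the pathwidth of $G$ is at most $3k$.
   Context: A row of $[k]\times[k]$ is a set $\{i\}\times[k]$. Construction: let $P_i=\{i\}\times[k]$ for $i\in[k]$, and let $\mathcal{S}$ be the family consisting of the $m$ sets $S_1,\dots,S_m$ and the $k$ sets $P_1,\dots,P_k$ (treated as $k+m$ distinct members). The graph $H$ has vertices $v_i^L$ ($i\in[k]$), $v_j^R$ ($j\in[k]$), and for every $X\in\mathcal{S}$ and $(i,j)\in X$ a vertex $v_{i,j}^X$; its edges are $v_i^Lv_{i,j}^X$ and $v_{i,j}^Xv_j^R$ for all $X\in\mathcal{S}$ and $(i,j)\in X$. The graph $G$ is obtained from $H$ by adding, for each $i\in[k]$, a new vertex $u_i^L$ adjacent only to $v_i^L$; for each $j\in[k]$, a new vertex $u_j^R$ adjacent only to $v_j^R$; and for each $X\in\mathcal{S}$, a new vertex $u^X$ adjacent exactly to the vertices $v_{i,j}^X$, $(i,j)\in X$. Pathwidth is the minimum width (maximum bag size minus one) of a path decomposition. -}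

module Defs where

open import Data.Nat using (ℕ; suc; _≤_)
open import Data.Fin using (Fin; _≟_) renaming (_≤_ to _≤ᶠ_)
open import Data.Bool using (Bool; T)
open import Data.Sum using (_⊎_; inj₁; inj₂)
open import Data.Product using (∃; _×_)
open import Data.List using (List; length)
open import Data.List.Membership.Propositional using (_∈_)
open import Relation.Binary.PropositionalEquality using (_≡_)
open import Relation.Nullary.Decidable using (⌊_⌋)

-- Undirectedness is irrelevant for path decompositions (an edge {u,v}
-- only requires a bag containing both u and v), so E may list each edge
-- in one orientation.
record Graph : Set₁ where
  field
    V : Set
    E : V → V → Set

record PathDecomposition (G : Graph) : Set where
  open Graph G
  field
    len      : ℕ
    bag      : Fin len → List V
    covers   : ∀ v → ∃ λ t → v ∈ bag t
    edges    : ∀ u v → E u v → ∃ λ t → (u ∈ bag t) × (v ∈ bag t)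
    interval : ∀ v (a b c : Fin len) → a ≤ᶠ b → b ≤ᶠ c →
               v ∈ bag a → v ∈ bag c → v ∈ bag b

PathwidthAtMost : Graph → ℕ → Set
PathwidthAtMost G w =
  ∃ λ (D : PathDecomposition G) →
    ∀ t → length (PathDecomposition.bag D t) ≤ suc w

CellSet : ℕ → Set
CellSet k = Fin k → Fin k → Bool

AtMostOnePerRow : ∀ {k} → CellSet k → Set
AtMostOnePerRow {k} S = ∀ (i j j' : Fin k) → T (S i j) → T (S i j') → j ≡ j'

-- Index set of the family 𝒮: inj₁ l is S_l (l ∈ [m]), inj₂ i is the row P_i.
FamIdx : ℕ → ℕ → Set
FamIdx k m = Fin m ⊎ Fin k

memb : ∀ {k m} → (Fin m → CellSet k) → FamIdx k m → Fin k → Fin k → Bool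
memb S (inj₁ l) i j = S l i j
memb S (inj₂ r) i j = ⌊ i ≟ r ⌋

data GVertex (k m : ℕ) (S : Fin m → CellSet k) : Set where
  vL  : Fin k → GVertex k m S
  vR  : Fin k → GVertex k m S
  vX  : (X : FamIdx k m) (i j : Fin k) → T (memb S X i j) → GVertex k m S
  uL  : Fin k → GVertex k m S
  uR  : Fin k → GVertex k m S
  uX  : FamIdx k m → GVertex k m S

data GEdge (k m : ℕ) (S : Fin m → CellSet k) : GVertex k m S → GVertex k m S → Set where
  eL  : ∀ X i j (p : T (memb S X i j)) → GEdge k m S (vL i) (vX X i j p)
  eR  : ∀ X i j (p : T (memb S X i j)) → GEdge k m S (vX X i j p) (vR j)
  euL : ∀ i → GEdge k m S (uL i) (vL i)
  euR : ∀ j → GEdge k m S (uR j) (vR j)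
  euX : ∀ X i j (p : T (memb S X i j)) → GEdge k m S (uX X) (vX X i j p)

GGraph : (k m : ℕ) → (Fin m → CellSet k) → Graph
GGraph k m S = record { V = GVertex k m S ; E = GEdge k m S }

{-# OPTIONS --safe #-}
-- Every bag contains the 2k vertices v_i^L and v_j^R. On top of these, each
-- X ∈ 𝒮 gets a bag holding u^X and the vertices v_{i,j}^X, of which there are
-- at most k because X meets each row at most once or is itself a row; each
-- u_i^L and u_j^R gets a bag of its own. Every vertex outside the common core
-- then lies in exactly one bag, so the bags may be listed in any order, and
-- the largest has 2k + (k + 1) vertices.
module Submission where

open import Defs
open import Data.Nat using (ℕ; _≤_; _*_; _+_; suc; s≤s; z≤n)
open import Data.Nat.Properties using (+-monoʳ-≤; +-suc; +-assoc; +-identityʳ; ≤-trans; ≤-reflexive; module ≤-Reasoning)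
open import Data.Fin using (Fin) renaming (_≤_ to _≤ᶠ_)
open import Data.Fin.Properties using (any?; +↔⊎) renaming (≤-antisym to ≤ᶠ-antisym)
open import Data.Bool using (T)
open import Data.Bool.Properties using (T-irrelevant)
open import Data.Maybe using (Maybe; just; nothing)
open import Data.Maybe.Relation.Unary.Any using () renaming (Any to MaybeAny; just to justAny)
open import Data.Sum using (_⊎_; inj₁; inj₂)
open import Data.Sum.Function.Propositional using (_⊎-↔_)
open import Data.Product using (Σ-syntax; ∃; _×_; _,_)
open import Data.List using (List; []; _∷_; _++_; map; mapMaybe; length; allFin)
open import Data.List.Properties using (length-++; length-map; length-mapMaybe; length-tabulate; Any-catMaybes⁺)
open import Data.List.Membership.Propositional using (_∈_)
open import Data.List.Membership.Propositional.Properties using (∈-++⁻; ∈-++⁺ˡ; ∈-++⁺ʳ; ∈-map⁺; ∈-map⁻; ∈-allFin)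
open import Data.List.Relation.Unary.Any using (here; there)
import Data.List.Relation.Unary.Any as Any
open import Function.Bundles using (_↔_; Inverse)
open import Function.Properties.Inverse using (↔-trans)
open import Relation.Binary.PropositionalEquality using (_≡_; refl; sym; trans; cong; cong₂; subst; module ≡-Reasoning)
open import Relation.Nullary using (yes; no; contradiction)
open import Relation.Nullary.Decidable using (fromWitness; toWitness; T?)

∈-mapMaybe⁺ : ∀ {A B : Set} (f : A → Maybe B) {xs : List A} {x : A} {y : B} →
              x ∈ xs → f x ≡ just y → y ∈ mapMaybe f xs
∈-mapMaybe⁺ f {x = x} {y} x∈xs fx≡y = Any-catMaybes⁺ (Any.map holds-y (∈-map⁺ f x∈xs))
  where
  holds-y : ∀ {z} → f x ≡ z → MaybeAny (y ≡_) z
  holds-y refl rewrite fx≡y = justAny refl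

module SharedCore (G : Graph)
  {I : Set} {n : ℕ} (position : Fin n ↔ I)
  (shared : List (Graph.V G)) (local : I → List (Graph.V G)) (home : Graph.V G → I)
  (local-home : ∀ t {v} → v ∈ local t → home v ≡ t)
  (covered : ∀ v → v ∈ shared ⊎ v ∈ local (home v))
  (edge-covered : ∀ u v → Graph.E G u v → ∃ λ t → u ∈ shared ++ local t × v ∈ shared ++ local t)
  where

  open Graph G

  open Inverse position using (to; from; strictlyInverseˡ; strictlyInverseʳ)

  bag : Fin n → List V
  bag a = shared ++ local (to a)

  ∈-bag-from : ∀ {t v} → v ∈ shared ++ local t → v ∈ bag (from t)
  ∈-bag-from {t} {v} = subst (λ s → v ∈ shared ++ local s) (sym (strictlyInverseˡ t))

  locals-coincide : ∀ {v a c} → v ∈ local (to a) → v ∈ local (to c) → a ≡ c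
  locals-coincide {v} {a} {c} v∈a v∈c = begin
    a                ≡⟨ strictlyInverseʳ a ⟨
    from (to a)      ≡⟨ cong from (trans (sym (local-home (to a) v∈a)) (local-home (to c) v∈c)) ⟩
    from (to c)      ≡⟨ strictlyInverseʳ c ⟩
    c                ∎
    where open ≡-Reasoning

  interval : ∀ v (a b c : Fin n) → a ≤ᶠ b → b ≤ᶠ c → v ∈ bag a → v ∈ bag c → v ∈ bag b
  interval v a b c a≤b b≤c v∈a v∈c with ∈-++⁻ shared v∈a | ∈-++⁻ shared v∈c
  ... | inj₁ v∈shared | _ = ∈-++⁺ˡ v∈shared
  ... | inj₂ _ | inj₁ v∈shared = ∈-++⁺ˡ v∈shared
  ... | inj₂ v∈a′ | inj₂ v∈c′ = subst (λ s → v ∈ bag s) a≡b v∈a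
    where
    a≡c : a ≡ c
    a≡c = locals-coincide v∈a′ v∈c′
    a≡b : a ≡ b
    a≡b = ≤ᶠ-antisym a≤b (subst (b ≤ᶠ_) (sym a≡c) b≤c)

  pathDecomposition : PathDecomposition G
  pathDecomposition = record
    { len      = n
    ; bag      = bag
    ; covers   = λ v → from (home v) , ∈-bag-from (cover v)
    ; edges    = λ u v e → let (t , u∈t , v∈t) = edge-covered u v e in from t , ∈-bag-from u∈t , ∈-bag-from v∈t
    ; interval = interval
    }
    where
    cover : ∀ v → v ∈ shared ++ local (home v)
    cover v with covered v
    ... | inj₁ v∈shared = ∈-++⁺ˡ v∈shared
    ... | inj₂ v∈local  = ∈-++⁺ʳ shared v∈local

  pathwidth≤ : ∀ w → (∀ t → length (local t) ≤ suc w) → PathwidthAtMost G (length shared + w)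
  pathwidth≤ w local≤ = pathDecomposition , λ a → begin
    length (shared ++ local (to a))        ≡⟨ length-++ shared ⟩
    length shared + length (local (to a))  ≤⟨ +-monoʳ-≤ (length shared) (local≤ (to a)) ⟩
    length shared + suc w                  ≡⟨ +-suc (length shared) w ⟩
    suc (length shared + w)                ∎
    where open ≤-Reasoning

module Construction (k m : ℕ) (S : Fin m → CellSet k) (one-per-row : ∀ l → AtMostOnePerRow (S l)) where

  V : Set
  V = GVertex k m S

  Cell : FamIdx k m → Set
  Cell X = Σ[ i ∈ Fin k ] Σ[ j ∈ Fin k ] T (memb S X i j)

  cellVertex : ∀ X → Cell X → V
  cellVertex X (i , j , p) = vX X i j p

  rowCell : ∀ l → Fin k → Maybe (Cell (inj₁ l))
  rowCell l i with any? (λ j → T? (S l i j))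
  ... | yes (j , p) = just (i , j , p)
  ... | no _        = nothing

  rowCell-unique : ∀ l i j (p : T (S l i j)) → rowCell l i ≡ just (i , j , p)
  rowCell-unique l i j p with any? (λ j → T? (S l i j))
  ... | no ¬cell = contradiction (j , p) ¬cell
  ... | yes (j′ , p′) with one-per-row l i j j′ p p′
  ...   | refl = cong (λ q → just (i , j , q)) (T-irrelevant p′ p)

  rowMember : ∀ r → Fin k → Cell (inj₂ r)
  rowMember r j = r , j , fromWitness refl

  cells : ∀ X → List (Cell X)
  cells (inj₁ l) = mapMaybe (rowCell l) (allFin k)
  cells (inj₂ r) = map (rowMember r) (allFin k)

  ∈-cells : ∀ X (c : Cell X) → c ∈ cells X
  ∈-cells (inj₁ l) (i , j , p) = ∈-mapMaybe⁺ (rowCell l) (∈-allFin i) (rowCell-unique l i j p)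
  ∈-cells (inj₂ r) (i , j , p) with toWitness p
  ... | refl = subst (λ q → (r , j , q) ∈ cells (inj₂ r)) (T-irrelevant (fromWitness refl) p)
                 (∈-map⁺ (rowMember r) (∈-allFin j))

  length-cells : ∀ X → length (cells X) ≤ k
  length-cells (inj₁ l) = ≤-trans (length-mapMaybe (rowCell l) (allFin k)) (≤-reflexive (length-tabulate {n = k} _))
  length-cells (inj₂ r) = ≤-reflexive (trans (length-map (rowMember r) (allFin k)) (length-tabulate {n = k} _))

  Index : Set
  Index = FamIdx k m ⊎ (Fin k ⊎ Fin k)

  position : Fin ((m + k) + (k + k)) ↔ Index
  position = ↔-trans +↔⊎ (+↔⊎ ⊎-↔ +↔⊎)

  shared : List V
  shared = map vL (allFin k) ++ map vR (allFin k)

  local : Index → List V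
  local (inj₁ X)        = uX X ∷ map (cellVertex X) (cells X)
  local (inj₂ (inj₁ i)) = uL i ∷ []
  local (inj₂ (inj₂ j)) = uR j ∷ []

  home : V → Index
  home (vL i)       = inj₂ (inj₁ i)
  home (vR j)       = inj₂ (inj₂ j)
  home (vX X _ _ _) = inj₁ X
  home (uL i)       = inj₂ (inj₁ i)
  home (uR j)       = inj₂ (inj₂ j)
  home (uX X)       = inj₁ X

  local-home : ∀ t {v} → v ∈ local t → home v ≡ t
  local-home (inj₁ X) (here refl) = refl
  local-home (inj₁ X) (there v∈cells) with ∈-map⁻ (cellVertex X) v∈cells
  ... | _ , _ , refl = refl
  local-home (inj₂ (inj₁ i)) (here refl) = refl
  local-home (inj₂ (inj₂ j)) (here refl) = refl

  vL∈shared : ∀ i → vL i ∈ shared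
  vL∈shared i = ∈-++⁺ˡ (∈-map⁺ vL (∈-allFin i))

  vR∈shared : ∀ j → vR j ∈ shared
  vR∈shared j = ∈-++⁺ʳ (map vL (allFin k)) (∈-map⁺ vR (∈-allFin j))

  vX∈local : ∀ X i j p → vX X i j p ∈ local (inj₁ X)
  vX∈local X i j p = there (∈-map⁺ (cellVertex X) (∈-cells X (i , j , p)))

  covered : ∀ v → v ∈ shared ⊎ v ∈ local (home v)
  covered (vL i)       = inj₁ (vL∈shared i)
  covered (vR j)       = inj₁ (vR∈shared j)
  covered (vX X i j p) = inj₂ (vX∈local X i j p)
  covered (uL i)       = inj₂ (here refl)
  covered (uR j)       = inj₂ (here refl)
  covered (uX X)       = inj₂ (here refl)

  edge-covered : ∀ u v → GEdge k m S u v → ∃ λ t → u ∈ shared ++ local t × v ∈ shared ++ local t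
  edge-covered _ _ (eL X i j p)  = inj₁ X , ∈-++⁺ˡ (vL∈shared i) , ∈-++⁺ʳ shared (vX∈local X i j p)
  edge-covered _ _ (eR X i j p)  = inj₁ X , ∈-++⁺ʳ shared (vX∈local X i j p) , ∈-++⁺ˡ (vR∈shared j)
  edge-covered _ _ (euL i)       = inj₂ (inj₁ i) , ∈-++⁺ʳ shared (here refl) , ∈-++⁺ˡ (vL∈shared i)
  edge-covered _ _ (euR j)       = inj₂ (inj₂ j) , ∈-++⁺ʳ shared (here refl) , ∈-++⁺ˡ (vR∈shared j)
  edge-covered _ _ (euX X i j p) = inj₁ X , ∈-++⁺ʳ shared (here refl) , ∈-++⁺ʳ shared (vX∈local X i j p)

  length-local : ∀ t → length (local t) ≤ suc k
  length-local (inj₁ X)        = s≤s (≤-trans (≤-reflexive (length-map (cellVertex X) (cells X))) (length-cells X))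
  length-local (inj₂ (inj₁ i)) = s≤s z≤n
  length-local (inj₂ (inj₂ j)) = s≤s z≤n

  length-shared+k≡3*k : length shared + k ≡ 3 * k
  length-shared+k≡3*k = begin
    length shared + k                ≡⟨ cong (_+ k) (length-++ (map vL (allFin k))) ⟩
    length (map vL (allFin k)) + length (map vR (allFin k)) + k
      ≡⟨ cong₂ (λ a b → a + b + k) (length-map vL (allFin k)) (length-map vR (allFin k)) ⟩
    length (allFin k) + length (allFin k) + k ≡⟨ cong (λ a → a + a + k) (length-tabulate {n = k} _) ⟩
    k + k + k                        ≡⟨ +-assoc k k k ⟩
    k + (k + k)                      ≡⟨ cong (λ a → k + (k + a)) (+-identityʳ k) ⟨
    3 * k                            ∎
    where open ≡-Reasoning

lemma6 : (k m : ℕ) → 1 ≤ k → 1 ≤ m →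
         (S : Fin m → CellSet k) → (∀ l → AtMostOnePerRow (S l)) →
         PathwidthAtMost (GGraph k m S) (3 * k)
lemma6 k m _ _ S one-per-row =
  subst (PathwidthAtMost (GGraph k m S)) length-shared+k≡3*k (pathwidth≤ k length-local)
  where
  open Construction k m S one-per-row
  open SharedCore (GGraph k m S) position shared local home local-home covered edge-covered
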